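{- The following graphs are double approval interval graphs: (1) the complete graphs $K_n$ for every positive integer $n$; (2) the cycles $C_n$ for every $n \geq 3$; (3) the wheels $W_n$ for every $n\ge3$; (4) the complete bipartite graphs $K_{m,n}$ for all positive integers $m,n$; (5) all (finite) trees.
   Context: All graphs are finite and simple. The wheel $W_n$ is the graph on $n+1$ vertices obtained from $C_n$ by adding a vertex adjacent to all cycle vertices. An approval interval is a triple $I(a)=(a_l,a_a,a_r)$ of reals with $a_l<a_a<a_r$: the closed interval $[a_l,a_r]$ with approval mark $a_a$. A double approval interval representation of a graph $G$ assigns to each vertex $a$ an approval interval $I(a)$ such that distinct vertices $a,b$ are adjacent if and only if $[a_l,a_r]$ and $[b_l,b_r]$ intersect and their intersection contains both approval marks $a_a$ and $b_a$. A graph is a double approval interval graph if it has such a representation. -}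

module Defs where

open import Data.Nat using (ℕ; zero; suc; _+_; _<_; _≤_)
open import Data.Fin using (Fin; toℕ)
import Data.Fin as F
open import Data.Rational using (ℚ) renaming (_<_ to _<q_; _≤_ to _≤q_)
open import Data.Product using (Σ; _×_; ∃)
open import Data.Sum using (_⊎_)
open import Data.Empty using (⊥)
open import Data.Unit using (⊤)
open import Data.List using (List; _∷_; []; _++_; length)
open import Data.List.Relation.Unary.Linked using (Linked)
open import Data.List.Relation.Unary.Unique.Propositional using (Unique)
open import Relation.Nullary using (¬_)
open import Relation.Binary.PropositionalEquality using (_≡_; _≢_)
open import Relation.Binary.Construct.Closure.ReflexiveTransitive using (Star)
open import Function.Bundles using (_⇔_)

record Graph : Set₁ where
  field
    size : ℕ
    Adj  : Fin size → Fin size → Set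
open Graph public

IsSimple : Graph → Set
IsSimple G = (∀ u v → Adj G u v → Adj G v u) × (∀ u → ¬ Adj G u u)

-- Approval interval (a_l, a_a, a_r) with a_l < a_a < a_r.
-- Reals are replaced by rationals.
record ApprovalInterval : Set where
  field
    left approval right : ℚ
    left<approval  : left <q approval
    approval<right : approval <q right
open ApprovalInterval public

_∈I_ : ℚ → ApprovalInterval → Set
x ∈I I = (left I ≤q x) × (x ≤q right I)

InIntersection : ℚ → ApprovalInterval → ApprovalInterval → Set
InIntersection x I J = (x ∈I I) × (x ∈I J)

DAAdjacent : ApprovalInterval → ApprovalInterval → Set
DAAdjacent I J =
  (Σ ℚ λ x → InIntersection x I J) ×
  InIntersection (approval I) I J × InIntersection (approval J) I J

IsDARepresentation : (G : Graph) → (Fin (size G) → ApprovalInterval) → Set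
IsDARepresentation G I =
  ∀ a b → a ≢ b → (Adj G a b ⇔ DAAdjacent (I a) (I b))

IsDoubleApprovalIntervalGraph : Graph → Set
IsDoubleApprovalIntervalGraph G =
  Σ (Fin (size G) → ApprovalInterval) λ I → IsDARepresentation G I

K : ℕ → Graph
K n = record { size = n ; Adj = λ i j → i ≢ j }

CycAdj : (n : ℕ) → Fin n → Fin n → Set
CycAdj n i j =
  (suc (toℕ i) ≡ toℕ j) ⊎ (suc (toℕ j) ≡ toℕ i)
  ⊎ ((toℕ i ≡ 0) × (suc (toℕ j) ≡ n)) ⊎ ((toℕ j ≡ 0) × (suc (toℕ i) ≡ n))

C : ℕ → Graph
C n = record { size = n ; Adj = CycAdj n }

-- Wheel W_n on Fin (suc n): vertex 0 is the hub, vertices suc i form C_n.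
WheelAdj : (n : ℕ) → Fin (suc n) → Fin (suc n) → Set
WheelAdj n F.zero F.zero = ⊥
WheelAdj n F.zero (F.suc j) = ⊤
WheelAdj n (F.suc i) F.zero = ⊤
WheelAdj n (F.suc i) (F.suc j) = CycAdj n i j

W : ℕ → Graph
W n = record { size = suc n ; Adj = WheelAdj n }

Kbip : ℕ → ℕ → Graph
Kbip m n = record
  { size = m + n
  ; Adj = λ i j → ((toℕ i < m) × (m ≤ toℕ j)) ⊎ ((m ≤ toℕ i) × (toℕ j < m)) }

Connected : Graph → Set
Connected G = ∀ u v → Star (Adj G) u v

HasCycle : Graph → Set
HasCycle G =
  Σ (Fin (size G)) λ v0 → Σ (List (Fin (size G))) λ vs →
    Unique (v0 ∷ vs) × (2 ≤ length vs) × Linked (Adj G) (v0 ∷ vs ++ v0 ∷ [])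

IsTree : Graph → Set
IsTree G = (1 ≤ size G) × IsSimple G × Connected G × ¬ HasCycle G

-- All representations use intervals with natural endpoints lo ≤ mark ≤ hi, in which two
-- vertices are adjacent iff each mark lies in the other interval. A tree is rooted and numbered in depth-first
-- preorder (the lexicographic order of root-to-vertex paths, which are unique since there are no
-- cycles): v approves at its rank, and its interval runs from the rank of its parent to the last
-- rank of its subtree. Mutual approval then forces one vertex to be an ancestor of the other, and
-- the interval of the descendant pins the ancestor down to its parent.
module Submission where

open import Defs
open import Data.Bool using (true)
open import Data.Empty using (⊥-elim)
open import Data.Fin as Fin using (Fin; toℕ; zero; suc)
import Data.Fin.Properties as Fin
open import Data.Fin.Subset as Subset using (Subset; ∣_∣)
open import Data.Fin.Subset.Properties using (p⊆q⇒∣p∣≤∣q∣; p⊂q⇒∣p∣<∣q∣)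
open import Data.Integer using (+_; +≤+; +<+)
import Data.Integer as ℤ
import Data.Integer.Properties as ℤ
open import Data.List using (List; []; _∷_; _∷ʳ_; _++_; reverse; length)
open import Data.List.Properties using (∷ʳ-injectiveʳ; unfold-reverse)
open import Data.List.Membership.Propositional using (_∈_; _∉_)
open import Data.List.Membership.Propositional.Properties using (∈-++⁺ˡ)
open import Data.List.Relation.Binary.Lex.Strict using (Lex-<; halt; this; next; base)
import Data.List.Relation.Binary.Lex.Strict as Lex
open import Data.List.Relation.Binary.Pointwise using (Pointwise-≡⇒≡; ≡⇒Pointwise-≡)
open import Data.List.Relation.Binary.Prefix.Heterogeneous using (Prefix; []; _∷_)
open import Data.List.Relation.Binary.Prefix.Heterogeneous.Properties using (prefix?; fromPointwise)
open import Data.List.Relation.Unary.All using ([]; _∷_)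
open import Data.List.Relation.Unary.All.Properties using (All¬⇒¬Any; ¬Any⇒All¬)
open import Data.List.Relation.Unary.AllPairs as AllPairs using ([]; _∷_)
open import Data.List.Relation.Unary.Any using (here; there)
open import Data.List.Relation.Unary.Linked as Linked using (Linked; []; [-]; _∷_)
open import Data.List.Relation.Unary.Unique.Propositional using (Unique)
open import Data.Nat as ℕ using (ℕ; zero; suc; _+_; _*_; _≤_; _<_; z≤n; s≤s)
import Data.Nat.Properties as ℕ
open import Data.Product using (Σ; ∃₂; _×_; _,_; proj₁; proj₂; swap)
open import Data.Product.Function.NonDependent.Propositional using (_×-⇔_)
open import Data.Rational using (ℚ; *≤*; *<*) renaming (_≤_ to _≤ℚ_; _<_ to _<ℚ_)
import Data.Rational.Properties as ℚ
open import Data.Rational.Literals using (fromℤ)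
open import Data.Sum using (_⊎_; inj₁; inj₂; [_,_]; [_,_]′)
open import Data.Unit using (tt)
open import Data.Vec using (tabulate)
open import Data.Vec.Properties using ([]=⇒lookup; lookup⇒[]=; lookup∘tabulate)
open import Function using (_∘_; const)
open import Function.Bundles using (_⇔_; mk⇔; Equivalence)
open import Function.Construct.Composition using (_⇔-∘_)
open import Function.Construct.Symmetry using (⇔-sym)
open import Relation.Binary using (tri<; tri≈; tri>)
open import Relation.Binary.Construct.Closure.ReflexiveTransitive using (Star; ε; _◅_)
open import Relation.Binary.PropositionalEquality
  using (_≡_; _≢_; refl; sym; trans; cong; subst; subst₂; isEquivalence)
open import Relation.Nullary using (¬_; Dec; yes; no; does)
open import Relation.Nullary.Decidable using (¬?; _⊎-dec_; _×-dec_)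
open import Relation.Unary using (Decidable)

-- Approval intervals from natural-number spans

fromℕ : ℕ → ℚ
fromℕ n = fromℤ (+ n)

fromℕ-≤⇔ : ∀ {m n} → fromℕ m ≤ℚ fromℕ n ⇔ m ≤ n
fromℕ-≤⇔ = mk⇔
  (λ { (*≤* le) → ℤ.drop‿+≤+ (subst₂ ℤ._≤_ (ℤ.*-identityʳ _) (ℤ.*-identityʳ _) le) })
  (λ le → *≤* (subst₂ ℤ._≤_ (sym (ℤ.*-identityʳ _)) (sym (ℤ.*-identityʳ _)) (+≤+ le)))

fromℕ-mono-< : ∀ {m n} → m < n → fromℕ m <ℚ fromℕ n
fromℕ-mono-< {m} {n} lt =
  *<* (subst₂ ℤ._<_ (sym (ℤ.*-identityʳ (+ m))) (sym (ℤ.*-identityʳ (+ n))) (+<+ lt))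

2m≤1+2n⇔m≤n : ∀ {m n} → 2 * m ≤ suc (2 * n) ⇔ m ≤ n
2m≤1+2n⇔m≤n {m} {n} = mk⇔ cancel (ℕ.m≤n⇒m≤1+n ∘ ℕ.*-monoʳ-≤ 2)
  where
  cancel : 2 * m ≤ suc (2 * n) → m ≤ n
  cancel le = ℕ.s≤s⁻¹ (ℕ.*-cancelˡ-< 2 m (suc n)
    (subst₂ _<_ refl (sym (ℕ.*-suc 2 n)) (s≤s le)))

approval∈I : ∀ I → approval I ∈I I
approval∈I I = ℚ.<⇒≤ (left<approval I) , ℚ.<⇒≤ (approval<right I)

-- The intersection is nonempty as soon as it contains a mark.
DAAdjacent⇔approvals-inside : ∀ I J →
  DAAdjacent I J ⇔ (approval I ∈I J × approval J ∈I I)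
DAAdjacent⇔approvals-inside I J = mk⇔
  (λ (_ , (_ , aI∈J) , (aJ∈I , _)) → aI∈J , aJ∈I)
  (λ (aI∈J , aJ∈I) →
    (approval I , approval∈I I , aI∈J) , (approval∈I I , aI∈J) , (aJ∈I , approval∈I J))

record Span : Set where
  constructor span
  field
    lo mark hi : ℕ
    lo≤mark : lo ≤ mark
    mark≤hi : mark ≤ hi
open Span

_∈ˢ_ : ℕ → Span → Set
x ∈ˢ s = lo s ≤ x × x ≤ hi s

SpanAdjacent : Span → Span → Set
SpanAdjacent s t = mark s ∈ˢ t × mark t ∈ˢ s

SpanAdjacent-comm : ∀ s t → SpanAdjacent s t ⇔ SpanAdjacent t s
SpanAdjacent-comm s t = mk⇔ swap swap

-- Doubling the coordinates and approving at the odd point 2m+1 makes the span strict.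
toApprovalInterval : Span → ApprovalInterval
toApprovalInterval s = record
  { left           = fromℕ (2 * lo s)
  ; approval       = fromℕ (suc (2 * mark s))
  ; right          = fromℕ (suc (suc (2 * hi s)))
  ; left<approval  = fromℕ-mono-< (s≤s (ℕ.*-monoʳ-≤ 2 (lo≤mark s)))
  ; approval<right = fromℕ-mono-< (s≤s (s≤s (ℕ.*-monoʳ-≤ 2 (mark≤hi s))))
  }

approval∈I⇔mark∈ˢ : ∀ s t →
  approval (toApprovalInterval s) ∈I toApprovalInterval t ⇔ mark s ∈ˢ t
approval∈I⇔mark∈ˢ s t =
  (2m≤1+2n⇔m≤n ⇔-∘ fromℕ-≤⇔)
    ×-⇔ (2m≤1+2n⇔m≤n ⇔-∘ (mk⇔ ℕ.s≤s⁻¹ s≤s ⇔-∘ fromℕ-≤⇔))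

DAAdjacent⇔SpanAdjacent : ∀ s t →
  DAAdjacent (toApprovalInterval s) (toApprovalInterval t) ⇔ SpanAdjacent s t
DAAdjacent⇔SpanAdjacent s t =
  (approval∈I⇔mark∈ˢ s t ×-⇔ approval∈I⇔mark∈ˢ t s)
    ⇔-∘ DAAdjacent⇔approvals-inside (toApprovalInterval s) (toApprovalInterval t)

IsSpanRepresentation : (G : Graph) → (Fin (size G) → Span) → Set
IsSpanRepresentation G f = ∀ a b → a ≢ b → Adj G a b ⇔ SpanAdjacent (f a) (f b)

spanRepresentation⇒DAIG : ∀ G f → IsSpanRepresentation G f → IsDoubleApprovalIntervalGraph G
spanRepresentation⇒DAIG G f rep = toApprovalInterval ∘ f , λ a b a≢b →
  ⇔-sym (DAAdjacent⇔SpanAdjacent (f a) (f b)) ⇔-∘ rep a b a≢b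

-- Complete, complete bipartite, cycle and wheel graphs

completeSpan : ∀ n → Fin n → Span
completeSpan n _ = span 0 0 0 z≤n z≤n

complete-representation : ∀ n → IsSpanRepresentation (K n) (completeSpan n)
complete-representation n a b a≢b = mk⇔ (const ((z≤n , z≤n) , (z≤n , z≤n))) (const a≢b)

bipartiteSpan : (m N k : ℕ) → k ≤ N → Dec (k < m) → Span
bipartiteSpan m N k k≤N (yes _) = span k k N ℕ.≤-refl k≤N
bipartiteSpan m N k k≤N (no _)  = span 0 k k z≤n ℕ.≤-refl

bipartiteSpan-adjacent : ∀ {m N k l} (k≤N : k ≤ N) (l≤N : l ≤ N) k<m? l<m? → k ≢ l →
  ((k < m × m ≤ l) ⊎ (m ≤ k × l < m)) ⇔
  SpanAdjacent (bipartiteSpan m N k k≤N k<m?) (bipartiteSpan m N l l≤N l<m?)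
bipartiteSpan-adjacent k≤N l≤N (yes k<m) (yes l<m) k≢l = mk⇔
  (λ { (inj₁ (_ , m≤l)) → ⊥-elim (ℕ.<⇒≱ l<m m≤l)
     ; (inj₂ (m≤k , _)) → ⊥-elim (ℕ.<⇒≱ k<m m≤k) })
  (λ ((l≤k , _) , (k≤l , _)) → ⊥-elim (k≢l (ℕ.≤-antisym k≤l l≤k)))
bipartiteSpan-adjacent k≤N l≤N (yes k<m) (no l≮m) k≢l = mk⇔
  (const ((z≤n , k≤l) , (k≤l , l≤N)))
  (const (inj₁ (k<m , ℕ.≮⇒≥ l≮m)))
  where k≤l = ℕ.<⇒≤ (ℕ.<-≤-trans k<m (ℕ.≮⇒≥ l≮m))
bipartiteSpan-adjacent k≤N l≤N (no k≮m) (yes l<m) k≢l = mk⇔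
  (const ((l≤k , k≤N) , (z≤n , l≤k)))
  (const (inj₂ (ℕ.≮⇒≥ k≮m , l<m)))
  where l≤k = ℕ.<⇒≤ (ℕ.<-≤-trans l<m (ℕ.≮⇒≥ k≮m))
bipartiteSpan-adjacent k≤N l≤N (no k≮m) (no l≮m) k≢l = mk⇔
  (λ { (inj₁ (k<m , _)) → ⊥-elim (k≮m k<m) ; (inj₂ (_ , l<m)) → ⊥-elim (l≮m l<m) })
  (λ ((_ , k≤l) , (_ , l≤k)) → ⊥-elim (k≢l (ℕ.≤-antisym k≤l l≤k)))

completeBipartiteSpan : ∀ m n → Fin (m + n) → Span
completeBipartiteSpan m n i =
  bipartiteSpan m (m + n) (toℕ i) (ℕ.<⇒≤ (Fin.toℕ<n i)) (toℕ i ℕ.<? m)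

completeBipartite-representation : ∀ m n →
  IsSpanRepresentation (Kbip m n) (completeBipartiteSpan m n)
completeBipartite-representation m n a b a≢b =
  bipartiteSpan-adjacent (ℕ.<⇒≤ (Fin.toℕ<n a)) (ℕ.<⇒≤ (Fin.toℕ<n b))
    (toℕ a ℕ.<? m) (toℕ b ℕ.<? m) (a≢b ∘ Fin.toℕ-injective)

adjacent⇔within-one : ∀ {m n} → m ≢ n →
                      (suc m ≡ n ⊎ suc n ≡ m) ⇔ (m ≤ suc n × n ≤ suc m)
adjacent⇔within-one {m} {n} m≢n = mk⇔
  (λ { (inj₁ refl) → ℕ.m≤n+m m 2 , ℕ.≤-refl ; (inj₂ refl) → ℕ.≤-refl , ℕ.m≤n+m n 2 })
  from
  where
  from : m ≤ suc n × n ≤ suc m → suc m ≡ n ⊎ suc n ≡ m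
  from (m≤1+n , n≤1+m) with ℕ.<-cmp m n
  ... | tri< m<n _ _ = inj₁ (ℕ.≤-antisym m<n n≤1+m)
  ... | tri≈ _ m≡n _ = ⊥-elim (m≢n m≡n)
  ... | tri> _ _ n<m = inj₂ (ℕ.≤-antisym n<m m≤1+n)

cycAdj? : ∀ n (i j : Fin n) → Dec (CycAdj n i j)
cycAdj? n i j =
  (suc (toℕ i) ℕ.≟ toℕ j) ⊎-dec (suc (toℕ j) ℕ.≟ toℕ i)
  ⊎-dec ((toℕ i ℕ.≟ 0) ×-dec (suc (toℕ j) ℕ.≟ n))
  ⊎-dec ((toℕ j ℕ.≟ 0) ×-dec (suc (toℕ i) ℕ.≟ n))

CycAdj-sym : ∀ {n i j} → CycAdj n i j → CycAdj n j i
CycAdj-sym (inj₁ e)               = inj₂ (inj₁ e)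
CycAdj-sym (inj₂ (inj₁ e))        = inj₁ e
CycAdj-sym (inj₂ (inj₂ (inj₁ e))) = inj₂ (inj₂ (inj₂ e))
CycAdj-sym (inj₂ (inj₂ (inj₂ e))) = inj₂ (inj₂ (inj₁ e))

bumpIf : {P : Set} → Dec P → ℕ → ℕ
bumpIf (yes _) t = suc t
bumpIf (no _)  t = t

≤bumpIf : ∀ {P} (p? : Dec P) t → t ≤ bumpIf p? t
≤bumpIf (yes _) t = ℕ.n≤1+n t
≤bumpIf (no _)  t = ℕ.≤-refl

1+≤bumpIf⇔ : ∀ {P} (p? : Dec P) t → suc t ≤ bumpIf p? t ⇔ P
1+≤bumpIf⇔ (yes p) t = mk⇔ (const p) (const ℕ.≤-refl)
1+≤bumpIf⇔ (no ¬p) t = mk⇔ (⊥-elim ∘ ℕ.<-irrefl refl) (⊥-elim ∘ ¬p)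

-- Vertices 1, …, n of C (n+1) form an interval path: i approves at i+1 and reaches back to i.
-- Vertex 0 approves at n+3, beyond all other marks; only the spans of its two neighbours are
-- stretched to reach it.
cycleSpan : ∀ n → Fin n → Span
cycleSpan (suc n) zero    = span 0 (3 + n) (3 + n) z≤n ℕ.≤-refl
cycleSpan (suc n) (suc j) =
  span (suc (toℕ j)) (2 + toℕ j) (bumpIf (cycAdj? (suc n) zero (suc j)) (2 + n))
    (ℕ.n≤1+n _) (ℕ.≤-trans (s≤s (s≤s (ℕ.<⇒≤ (Fin.toℕ<n j)))) (≤bumpIf _ _))

cycleSpan-covers-1+n : ∀ n i → suc n ∈ˢ cycleSpan n i
cycleSpan-covers-1+n (suc n) zero    = z≤n , ℕ.n≤1+n _
cycleSpan-covers-1+n (suc n) (suc j) =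
  s≤s (ℕ.m≤n⇒m≤1+n (ℕ.<⇒≤ (Fin.toℕ<n j))) , ≤bumpIf _ _

cycleSpan-mark≤2+n : ∀ n i → mark (cycleSpan n i) ≤ 2 + n
cycleSpan-mark≤2+n (suc n) zero    = ℕ.≤-refl
cycleSpan-mark≤2+n (suc n) (suc j) = s≤s (s≤s (ℕ.m≤n⇒m≤1+n (ℕ.<⇒≤ (Fin.toℕ<n j))))

cycleSpan-first-adjacent : ∀ n (j : Fin n) →
  CycAdj (suc n) zero (suc j) ⇔ SpanAdjacent (cycleSpan (suc n) zero) (cycleSpan (suc n) (suc j))
cycleSpan-first-adjacent n j = mk⇔
  (λ c → (lo≤3+n , Equivalence.from reaches-n+3⇔ c) , (z≤n , cycleSpan-mark≤2+n (suc n) (suc j)))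
  (λ ((_ , reaches-n+3) , _) → Equivalence.to reaches-n+3⇔ reaches-n+3)
  where
  lo≤3+n = ℕ.≤-trans (lo≤mark (cycleSpan (suc n) (suc j))) (cycleSpan-mark≤2+n (suc n) (suc j))
  reaches-n+3⇔ = 1+≤bumpIf⇔ (cycAdj? (suc n) zero (suc j)) (2 + n)

cycleSpan-path-adjacent : ∀ n (i j : Fin n) → toℕ i ≢ toℕ j →
  CycAdj (suc n) (suc i) (suc j) ⇔ SpanAdjacent (cycleSpan (suc n) (suc i)) (cycleSpan (suc n) (suc j))
cycleSpan-path-adjacent n i j i≢j = mk⇔ to from
  where
  within-one = adjacent⇔within-one (i≢j ∘ ℕ.suc-injective)
  mark≤hi′ : ∀ i j → 2 + toℕ i ≤ hi (cycleSpan (suc n) (suc j))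
  mark≤hi′ i j = ℕ.≤-trans (s≤s (s≤s (ℕ.<⇒≤ (Fin.toℕ<n i)))) (≤bumpIf _ _)
  successor : CycAdj (suc n) (suc i) (suc j) →
              suc (suc (toℕ i)) ≡ suc (toℕ j) ⊎ suc (suc (toℕ j)) ≡ suc (toℕ i)
  successor (inj₁ e)                     = inj₁ e
  successor (inj₂ (inj₁ e))              = inj₂ e
  successor (inj₂ (inj₂ (inj₁ (() , _))))
  successor (inj₂ (inj₂ (inj₂ (() , _))))
  to : CycAdj (suc n) (suc i) (suc j) → _
  to c with Equivalence.to within-one (successor c)
  ... | i≤1+j , j≤1+i = (j≤1+i , mark≤hi′ i j) , (i≤1+j , mark≤hi′ j i)
  from : SpanAdjacent (cycleSpan (suc n) (suc i)) (cycleSpan (suc n) (suc j)) → _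
  from ((j≤1+i , _) , (i≤1+j , _)) with Equivalence.from within-one (i≤1+j , j≤1+i)
  ... | inj₁ e = inj₁ e
  ... | inj₂ e = inj₂ (inj₁ e)

cycle-representation : ∀ n → IsSpanRepresentation (C n) (cycleSpan n)
cycle-representation (suc n) zero    zero    0≢0 = ⊥-elim (0≢0 refl)
cycle-representation (suc n) zero    (suc j) _   = cycleSpan-first-adjacent n j
cycle-representation (suc n) (suc i) zero    _   =
  SpanAdjacent-comm (cycleSpan (suc n) zero) (cycleSpan (suc n) (suc i))
    ⇔-∘ (cycleSpan-first-adjacent n i ⇔-∘ mk⇔ CycAdj-sym CycAdj-sym)
cycle-representation (suc n) (suc i) (suc j) i≢j =
  cycleSpan-path-adjacent n i j (i≢j ∘ cong suc ∘ Fin.toℕ-injective)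

wheelSpan : ∀ n → Fin (suc n) → Span
wheelSpan n zero    = span 0 (suc n) (2 + n) z≤n (ℕ.n≤1+n _)
wheelSpan n (suc i) = cycleSpan n i

-- Every span of the rim contains n+1, where the hub approves.
hub-adjacent : ∀ n i → SpanAdjacent (wheelSpan n zero) (cycleSpan n i)
hub-adjacent n i = cycleSpan-covers-1+n n i , (z≤n , cycleSpan-mark≤2+n n i)

wheel-representation : ∀ n → IsSpanRepresentation (W n) (wheelSpan n)
wheel-representation n zero    zero    0≢0 = ⊥-elim (0≢0 refl)
wheel-representation n zero    (suc j) _   = mk⇔ (const (hub-adjacent n j)) (const tt)
wheel-representation n (suc i) zero    _   = mk⇔ (const (swap (hub-adjacent n i))) (const tt)
wheel-representation n (suc i) (suc j) i≢j = cycle-representation n i j (i≢j ∘ cong suc)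

-- Counting, and lexicographic order of lists

does≡true⇔ : ∀ {A : Set} (a? : Dec A) → does a? ≡ true ⇔ A
does≡true⇔ (yes a) = mk⇔ (const a) (const refl)
does≡true⇔ (no ¬a) = mk⇔ (λ ()) (⊥-elim ∘ ¬a)

subsetOf : ∀ {n} {P : Fin n → Set} → Decidable P → Subset n
subsetOf P? = tabulate (does ∘ P?)

∈-subsetOf⇔ : ∀ {n} {P : Fin n → Set} (P? : Decidable P) {x} → x Subset.∈ subsetOf P? ⇔ P x
∈-subsetOf⇔ P? {x} = does≡true⇔ (P? x) ⇔-∘ mk⇔
  (λ x∈ → trans (sym (lookup∘tabulate _ x)) ([]=⇒lookup x∈))
  (λ holds → lookup⇒[]= x _ (trans (lookup∘tabulate _ x) holds))

count : ∀ {n} {P : Fin n → Set} → Decidable P → ℕ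
count P? = ∣ subsetOf P? ∣

module _ {n} {P Q : Fin n → Set} (P? : Decidable P) (Q? : Decidable Q) where

  count-mono : (∀ {x} → P x → Q x) → count P? ≤ count Q?
  count-mono P⊆Q = p⊆q⇒∣p∣≤∣q∣
    (Equivalence.from (∈-subsetOf⇔ Q?) ∘ P⊆Q ∘ Equivalence.to (∈-subsetOf⇔ P?))

  count-strictMono : (∀ {x} → P x → Q x) → ∀ y → Q y → ¬ P y → count P? < count Q?
  count-strictMono P⊆Q y Qy ¬Py = p⊂q⇒∣p∣<∣q∣
    ( Equivalence.from (∈-subsetOf⇔ Q?) ∘ P⊆Q ∘ Equivalence.to (∈-subsetOf⇔ P?)
    , y , Equivalence.from (∈-subsetOf⇔ Q?) Qy , ¬Py ∘ Equivalence.to (∈-subsetOf⇔ P?))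

module _ {A : Set} {_<_ : A → A → Set} where

  ⊑-≺-trans : ∀ {as bs cs} → Prefix _≡_ as bs → Lex-< _≡_ _<_ bs cs → Lex-< _≡_ _<_ as cs
  ⊑-≺-trans []         (base ())
  ⊑-≺-trans []         halt          = halt
  ⊑-≺-trans []         (this _)      = halt
  ⊑-≺-trans []         (next _ _)    = halt
  ⊑-≺-trans (refl ∷ p) (this x<y)    = this x<y
  ⊑-≺-trans (refl ∷ p) (next refl q) = next refl (⊑-≺-trans p q)

  -- In lexicographic order the extensions of a list form an interval.
  extension-≺ : ∀ {as bs cs} → Prefix _≡_ as bs → Lex-< _≡_ _<_ as cs →
                ¬ Prefix _≡_ as cs → Lex-< _≡_ _<_ bs cs
  extension-≺ []         _             ¬as⊑cs = ⊥-elim (¬as⊑cs [])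
  extension-≺ (refl ∷ p) (this x<y)    _      = this x<y
  extension-≺ (refl ∷ p) (next refl q) ¬as⊑cs =
    next refl (extension-≺ p q (¬as⊑cs ∘ (refl ∷_)))

module _ {A : Set} where

  ⊑-∷ʳ : ∀ (bs : List A) {x} → Prefix _≡_ bs (bs ∷ʳ x)
  ⊑-∷ʳ []       = []
  ⊑-∷ʳ (b ∷ bs) = refl ∷ ⊑-∷ʳ bs

  ⊑-∷ʳ⁻ : ∀ {as} (bs : List A) {x} → Prefix _≡_ as (bs ∷ʳ x) →
          Prefix _≡_ as bs ⊎ as ≡ bs ∷ʳ x
  ⊑-∷ʳ⁻ []       []          = inj₁ []
  ⊑-∷ʳ⁻ []       (refl ∷ []) = inj₂ refl
  ⊑-∷ʳ⁻ (b ∷ bs) []          = inj₁ []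
  ⊑-∷ʳ⁻ (b ∷ bs) (refl ∷ p)  with ⊑-∷ʳ⁻ bs p
  ... | inj₁ q = inj₁ (refl ∷ q)
  ... | inj₂ e = inj₂ (cong (b ∷_) e)

module _ {N : ℕ} where

  infix 4 _≺_ _⊑_

  _≺_ : List (Fin N) → List (Fin N) → Set
  _≺_ = Lex-< _≡_ Fin._<_

  _⊑_ : List (Fin N) → List (Fin N) → Set
  _⊑_ = Prefix _≡_

  ≺-trans : ∀ {as bs cs} → as ≺ bs → bs ≺ cs → as ≺ cs
  ≺-trans = Lex.<-transitive isEquivalence Fin.<-resp₂-≡ Fin.<-trans

  ≺-irrefl : ∀ {as} → ¬ as ≺ as
  ≺-irrefl = Lex.<-irreflexive Fin.<-irrefl (≡⇒Pointwise-≡ refl)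

  ≺-asym : ∀ {as bs} → as ≺ bs → ¬ bs ≺ as
  ≺-asym = Lex.<-asymmetric sym Fin.<-resp₂-≡ Fin.<-asym

  ≺-cmp : ∀ as bs → as ≺ bs ⊎ as ≡ bs ⊎ bs ≺ as
  ≺-cmp as bs with Lex.<-compare sym Fin.<-cmp as bs
  ... | tri< as≺bs _ _ = inj₁ as≺bs
  ... | tri≈ _ as≋bs _ = inj₂ (inj₁ (Pointwise-≡⇒≡ as≋bs))
  ... | tri> _ _ bs≺as = inj₂ (inj₂ bs≺as)

  _≺?_ : ∀ as bs → Dec (as ≺ bs)
  _≺?_ = Lex.<-decidable Fin._≟_ Fin._<?_

  _⊑?_ : ∀ as bs → Dec (as ⊑ bs)
  _⊑?_ = prefix? Fin._≟_

  ≡⇒⊑ : ∀ {as bs} → as ≡ bs → as ⊑ bs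
  ≡⇒⊑ = fromPointwise ∘ ≡⇒Pointwise-≡

-- Depth-first spans of a rooted tree

record RootedTree (N : ℕ) : Set where
  field
    root           : Fin N
    parent         : Fin N → Fin N
    ancestors      : Fin N → List (Fin N)
    parent-root    : parent root ≡ root
    ancestors-root : ancestors root ≡ []
    ancestors-step : ∀ {v} → v ≢ root → ancestors v ≡ parent v ∷ ancestors (parent v)

  ParentOrChild : Fin N → Fin N → Set
  ParentOrChild u v = u ≡ parent v ⊎ v ≡ parent u

module DepthFirst {N} (T : RootedTree N) where
  open RootedTree T

  address : Fin N → List (Fin N)
  address v = reverse (ancestors v) ∷ʳ v

  Ancestor : Fin N → Fin N → Set
  Ancestor u v = address u ⊑ address v

  address-injective : ∀ {u v} → address u ≡ address v → u ≡ v
  address-injective = ∷ʳ-injectiveʳ _ _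

  reverse-ancestors : ∀ {v} → v ≢ root → reverse (ancestors v) ≡ address (parent v)
  reverse-ancestors {v} v≢root =
    trans (cong reverse (ancestors-step v≢root)) (unfold-reverse (parent v) (ancestors (parent v)))

  ¬address⊑[] : ∀ u → ¬ address u ⊑ []
  ¬address⊑[] u with reverse (ancestors u)
  ... | []    = λ ()
  ... | _ ∷ _ = λ ()

  parent-ancestor : ∀ v → Ancestor (parent v) v
  parent-ancestor v with v Fin.≟ root
  ... | yes refl = ≡⇒⊑ (cong address parent-root)
  ... | no v≢root =
    subst₂ _⊑_ refl (cong (_∷ʳ v) (sym (reverse-ancestors v≢root))) (⊑-∷ʳ (address (parent v)))

  ancestor-parent : ∀ {u v} → Ancestor u v → u ≢ v → Ancestor u (parent v)
  ancestor-parent {u} {v} u⊑v u≢v with ⊑-∷ʳ⁻ (reverse (ancestors v)) u⊑v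
  ... | inj₂ e = ⊥-elim (u≢v (address-injective e))
  ... | inj₁ u⊑ with v Fin.≟ root
  ...   | no v≢root = subst₂ _⊑_ refl (reverse-ancestors v≢root) u⊑
  ...   | yes refl =
    ⊥-elim (¬address⊑[] u (subst (λ a → address u ⊑ reverse a) ancestors-root u⊑))

  NotAfter BeforeOrBelow : Fin N → Fin N → Set
  NotAfter v x      = ¬ address v ≺ address x
  BeforeOrBelow v x = address x ≺ address v ⊎ address v ⊑ address x

  notAfter? : ∀ v → Decidable (NotAfter v)
  notAfter? v x = ¬? (address v ≺? address x)

  beforeOrBelow? : ∀ v → Decidable (BeforeOrBelow v)
  beforeOrBelow? v x = (address x ≺? address v) ⊎-dec (address v ⊑? address x)

  -- discovery v is the 1-based rank of v in preorder (lexicographic order of addresses),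
  -- finish v the largest rank in the subtree of v.
  discovery finish : Fin N → ℕ
  discovery v = count (notAfter? v)
  finish v    = count (beforeOrBelow? v)

  ≺⇒discovery< : ∀ {u v} → address u ≺ address v → discovery u < discovery v
  ≺⇒discovery< {u} {v} u≺v = count-strictMono (notAfter? u) (notAfter? v)
    (λ ¬u≺x v≺x → ¬u≺x (≺-trans u≺v v≺x)) v ≺-irrefl (λ ¬u≺v → ¬u≺v u≺v)

  discovery-injective : ∀ {u v} → discovery u ≡ discovery v → u ≡ v
  discovery-injective {u} {v} eq with ≺-cmp (address u) (address v)
  ... | inj₁ u≺v        = ⊥-elim (ℕ.<-irrefl eq (≺⇒discovery< u≺v))
  ... | inj₂ (inj₁ e)   = address-injective e
  ... | inj₂ (inj₂ v≺u) = ⊥-elim (ℕ.<-irrefl (sym eq) (≺⇒discovery< v≺u))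

  ancestor⇒discovery≤ : ∀ {u v} → Ancestor u v → discovery u ≤ discovery v
  ancestor⇒discovery≤ {u} {v} u⊑v =
    count-mono (notAfter? u) (notAfter? v) (λ ¬u≺x v≺x → ¬u≺x (⊑-≺-trans u⊑v v≺x))

  ancestor⇒discovery≤finish : ∀ {u v} → Ancestor u v → discovery v ≤ finish u
  ancestor⇒discovery≤finish {u} {v} u⊑v =
    count-mono (notAfter? v) (beforeOrBelow? u) before-or-below
    where
    before-or-below : ∀ {x} → NotAfter v x → BeforeOrBelow u x
    before-or-below {x} ¬v≺x with address u ⊑? address x | ≺-cmp (address x) (address u)
    ... | yes u⊑x | _                   = inj₂ u⊑x
    ... | no _    | inj₁ x≺u            = inj₁ x≺u
    ... | no ¬u⊑x | inj₂ (inj₁ x≡u)     = ⊥-elim (¬u⊑x (≡⇒⊑ (sym x≡u)))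
    ... | no ¬u⊑x | inj₂ (inj₂ u≺x)     = ⊥-elim (¬v≺x (extension-≺ u⊑v u≺x ¬u⊑x))

  discovery-between⇒ancestor : ∀ {u v} → discovery u ≤ discovery v → discovery v ≤ finish u →
                               Ancestor u v
  discovery-between⇒ancestor {u} {v} du≤dv dv≤fu with address u ⊑? address v
  ... | yes u⊑v = u⊑v
  ... | no ¬u⊑v = ⊥-elim (ℕ.<⇒≱ finish<discovery dv≤fu)
    where
    u≺v : address u ≺ address v
    u≺v with ≺-cmp (address u) (address v)
    ... | inj₁ u≺v        = u≺v
    ... | inj₂ (inj₁ e)   = ⊥-elim (¬u⊑v (≡⇒⊑ e))
    ... | inj₂ (inj₂ v≺u) = ⊥-elim (ℕ.<⇒≱ (≺⇒discovery< v≺u) du≤dv)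
    not-after-v : ∀ {x} → BeforeOrBelow u x → NotAfter v x
    not-after-v (inj₁ x≺u) v≺x = ≺-asym u≺v (≺-trans v≺x x≺u)
    not-after-v (inj₂ u⊑x) v≺x = ≺-asym v≺x (extension-≺ u⊑x u≺v ¬u⊑v)
    finish<discovery : finish u < discovery v
    finish<discovery = count-strictMono (beforeOrBelow? u) (notAfter? v) not-after-v
      v ≺-irrefl [ ≺-asym u≺v , ¬u⊑v ]

  dfsSpan : Fin N → Span
  dfsSpan v = span (discovery (parent v)) (discovery v) (finish v)
    (ancestor⇒discovery≤ (parent-ancestor v)) (ancestor⇒discovery≤finish (≡⇒⊑ refl))

  parent-spanAdjacent : ∀ v → SpanAdjacent (dfsSpan (parent v)) (dfsSpan v)
  parent-spanAdjacent v =
    (ℕ.≤-refl , ℕ.≤-trans (ancestor⇒discovery≤ (parent-ancestor v)) (mark≤hi (dfsSpan v))) ,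
    (ℕ.≤-trans (lo≤mark (dfsSpan (parent v))) (ancestor⇒discovery≤ (parent-ancestor v)) ,
     ancestor⇒discovery≤finish (parent-ancestor v))

  adjacent⇒parent : ∀ {u v} → discovery u ≤ discovery v → u ≢ v →
                    SpanAdjacent (dfsSpan u) (dfsSpan v) → u ≡ parent v
  adjacent⇒parent du≤dv u≢v ((dpv≤du , _) , (_ , dv≤fu)) =
    discovery-injective (ℕ.≤-antisym (ancestor⇒discovery≤ u⊑pv) dpv≤du)
    where u⊑pv = ancestor-parent (discovery-between⇒ancestor du≤dv dv≤fu) u≢v

  dfs-representation : ∀ {u v} → u ≢ v → ParentOrChild u v ⇔ SpanAdjacent (dfsSpan u) (dfsSpan v)
  dfs-representation {u} {v} u≢v = mk⇔
    (λ { (inj₁ refl) → parent-spanAdjacent v ; (inj₂ refl) → swap (parent-spanAdjacent u) })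
    (λ adj → [ (λ du≤dv → inj₁ (adjacent⇒parent du≤dv u≢v adj))
             , (λ dv≤du → inj₂ (adjacent⇒parent dv≤du (u≢v ∘ sym) (swap adj))) ]′
             (ℕ.≤-total (discovery u) (discovery v)))

-- Paths in a tree

lastOf : ∀ {A : Set} → A → List A → A
lastOf x []       = x
lastOf x (y ∷ ys) = lastOf y ys

lastOf-∈ : ∀ {A : Set} (x : A) xs → lastOf x xs ∈ x ∷ xs
lastOf-∈ x []       = here refl
lastOf-∈ x (y ∷ ys) = there (lastOf-∈ y ys)

Linked-∷ʳ : ∀ {A : Set} {R : A → A → Set} {x z} xs → Linked R (x ∷ xs) → R (lastOf x xs) z →
            Linked R (x ∷ xs ∷ʳ z)
Linked-∷ʳ []       [-]      r = r ∷ [-]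
Linked-∷ʳ (y ∷ ys) (r ∷ rs) r′ = r ∷ Linked-∷ʳ ys rs r′

module SimplePaths (G : Graph) (adj-sym : ∀ u v → Adj G u v → Adj G v u) (acyclic : ¬ HasCycle G) where

  private
    V = Fin (size G)
    _~_ = Adj G

  open import Data.List.Membership.DecPropositional (Fin._≟_ {size G}) using (_∈?_)

  record Path (x y : V) (s : List V) : Set where
    field
      linked : Linked _~_ (x ∷ s)
      unique : Unique (x ∷ s)
      ends   : lastOf x s ≡ y

  open Path

  Path-[] : ∀ x → Path x x []
  Path-[] x = record { linked = [-] ; unique = [] ∷ [] ; ends = refl }

  Path-head : ∀ {x y w s} → Path x y (w ∷ s) → x ~ w
  Path-head p = Linked.head (linked p)

  Path-tail : ∀ {x y w s} → Path x y (w ∷ s) → Path w y s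
  Path-tail p = record
    { linked = Linked.tail (linked p) ; unique = AllPairs.tail (unique p) ; ends = ends p }

  Path-∉ : ∀ {x y s} → Path x y s → x ∉ s
  Path-∉ p = All¬⇒¬Any (AllPairs.head (unique p))

  Path-∷ : ∀ {x y w s} → x ~ w → x ∉ w ∷ s → Path w y s → Path x y (w ∷ s)
  Path-∷ {s = s} x~w x∉ p = record
    { linked = x~w ∷ linked p
    ; unique = ¬Any⇒All¬ (_ ∷ s) x∉ ∷ unique p
    ; ends   = ends p }

  Path-split : ∀ {x y z} s → Path x y s → z ∈ x ∷ s →
               ∃₂ λ s₁ s₂ → Path x z s₁ × Path z y s₂ × s ≡ s₁ ++ s₂
  Path-split s p (here refl) = [] , s , Path-[] _ , p , refl
  Path-split (w ∷ s) p (there z∈) with Path-split s (Path-tail p) z∈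
  ... | s₁ , s₂ , p₁ , p₂ , refl =
    w ∷ s₁ , s₂ , Path-∷ (Path-head p) (Path-∉ p ∘ ∈-++⁺ˡ) p₁ , p₂ , refl

  Path-close : ∀ {x y s} → Path x y s → y ~ x → 2 ≤ length s → HasCycle G
  Path-close {x} {s = s} p y~x 2≤ =
    x , s , unique p , 2≤ , Linked-∷ʳ s (linked p) (subst (_~ x) (sym (ends p)) y~x)

  -- Walk from x along the path through a; if it meets the path through b, the two close a cycle
  -- through x; otherwise step to the next vertex of the first path, with x joining the second.
  no-fork : ∀ {x a b y} as bs → x ~ a → x ~ b → a ≢ b → Path a y as → Path b y bs →
            x ∉ a ∷ as → x ∉ b ∷ bs → HasCycle G
  no-fork {x} {a} {b} as bs x~a x~b a≢b pa pb x∉pa x∉pb with a ∈? b ∷ bs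
  ... | yes a∈pb with Path-split bs pb a∈pb
  ...   | [] , _ , pba , _ , _ = ⊥-elim (a≢b (sym (ends pba)))
  ...   | _ ∷ _ , _ , pba , _ , refl =
          Path-close (Path-∷ x~b (x∉pb ∘ ∈-++⁺ˡ) pba) (adj-sym x a x~a) (s≤s (s≤s z≤n))
  no-fork [] bs x~a x~b a≢b pa pb x∉pa x∉pb | no a∉pb =
    ⊥-elim (a∉pb (subst (_∈ _ ∷ bs) (trans (ends pb) (sym (ends pa))) (lastOf-∈ _ bs)))
  no-fork {x} {a} (_ ∷ as) bs x~a x~b a≢b pa pb x∉pa x∉pb | no a∉pb =
    no-fork as (_ ∷ bs) (Path-head pa) (adj-sym x a x~a) (x∉pa ∘ there ∘ here ∘ sym)
      (Path-tail pa) (Path-∷ x~b x∉pb pb) (Path-∉ pa)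
      λ { (here a≡x) → x∉pa (here (sym a≡x)) ; (there a∈pb) → a∉pb a∈pb }

  Path-unique : ∀ {x y s t} → Path x y s → Path x y t → s ≡ t
  Path-unique {s = []}    {[]}    _  _  = refl
  Path-unique {s = []}    {w ∷ t} ps pt =
    ⊥-elim (Path-∉ pt (subst (_∈ w ∷ t) (trans (ends pt) (sym (ends ps))) (lastOf-∈ w t)))
  Path-unique {s = w ∷ s} {[]}    ps pt =
    ⊥-elim (Path-∉ ps (subst (_∈ w ∷ s) (trans (ends ps) (sym (ends pt))) (lastOf-∈ w s)))
  Path-unique {s = a ∷ s} {b ∷ t} ps pt with a Fin.≟ b
  ... | yes refl = cong (a ∷_) (Path-unique (Path-tail ps) (Path-tail pt))
  ... | no a≢b   = ⊥-elim (acyclic (no-fork s t (Path-head ps) (Path-head pt) a≢b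
                     (Path-tail ps) (Path-tail pt) (Path-∉ ps) (Path-∉ pt)))

  Star⇒Path : ∀ {x y} → Star _~_ x y → Σ (List V) (Path x y)
  Star⇒Path {x} ε = [] , Path-[] x
  Star⇒Path {x} (x~w ◅ walk) with Star⇒Path walk
  ... | s , p with x ∈? _ ∷ s
  ...   | yes x∈ with Path-split s p x∈
  ...     | _ , s₂ , _ , p₂ , _ = s₂ , p₂
  Star⇒Path {x} (x~w ◅ walk) | s , p | no x∉ = _ ∷ s , Path-∷ x~w x∉ p

  module Rooted (connected : Connected G) (root : V) where

    ancestors : V → List V
    ancestors v = proj₁ (Star⇒Path (connected v root))

    ancestors-path : ∀ v → Path v root (ancestors v)
    ancestors-path v = proj₂ (Star⇒Path (connected v root))

    headOr : V → List V → V
    headOr v []      = v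
    headOr v (w ∷ _) = w

    parent : V → V
    parent v = headOr v (ancestors v)

    ancestors-root : ancestors root ≡ []
    ancestors-root = Path-unique (ancestors-path root) (Path-[] root)

    path-step : ∀ {v} s → Path v root s → v ≢ root → s ≡ headOr v s ∷ ancestors (headOr v s)
    path-step []      p v≢root = ⊥-elim (v≢root (ends p))
    path-step (w ∷ s) p _      = cong (w ∷_) (Path-unique (Path-tail p) (ancestors-path w))

    path-head : ∀ {v} s → Path v root s → v ≢ root → v ~ headOr v s
    path-head []      p v≢root = ⊥-elim (v≢root (ends p))
    path-head (w ∷ s) p _      = Path-head p

    rootedTree : RootedTree (size G)
    rootedTree = record
      { root           = root
      ; parent         = parent
      ; ancestors      = ancestors
      ; parent-root    = cong (headOr root) ancestors-root
      ; ancestors-root = ancestors-root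
      ; ancestors-step = λ {v} → path-step (ancestors v) (ancestors-path v)
      }

    open RootedTree rootedTree using (ParentOrChild; parent-root)

    parent-adjacent : ∀ {u v} → u ≡ parent v → u ≢ v → u ~ v
    parent-adjacent {v = v} refl pv≢v =
      adj-sym v (parent v) (path-head (ancestors v) (ancestors-path v) v≢root)
      where v≢root = λ { refl → pv≢v parent-root }

    adjacent⇒parentOrChild : ∀ {u v} → u ~ v → u ≢ v → ParentOrChild u v
    adjacent⇒parentOrChild {u} {v} u~v u≢v with v ∈? u ∷ ancestors u
    ... | no v∉ = inj₁ (sym (cong (headOr v)
            (Path-unique (ancestors-path v) (Path-∷ (adj-sym u v u~v) v∉ (ancestors-path u)))))
    ... | yes v∈ with Path-split (ancestors u) (ancestors-path u) v∈
    ...   | [] , _ , p₁ , _ , _ = ⊥-elim (u≢v (ends p₁))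
    ...   | _ ∷ [] , _ , p₁ , _ , e = inj₂ (trans (sym (ends p₁)) (sym (cong (headOr u) e)))
    ...   | _ ∷ _ ∷ _ , _ , p₁ , _ , _ =
            ⊥-elim (acyclic (Path-close p₁ (adj-sym u v u~v) (s≤s (s≤s z≤n))))

    adjacent⇔parentOrChild : ∀ {u v} → u ≢ v → u ~ v ⇔ ParentOrChild u v
    adjacent⇔parentOrChild u≢v = mk⇔ (λ u~v → adjacent⇒parentOrChild u~v u≢v)
      λ { (inj₁ u≡pv) → parent-adjacent u≡pv u≢v
        ; (inj₂ v≡pu) → adj-sym _ _ (parent-adjacent v≡pu (u≢v ∘ sym)) }

tree-representation : ∀ G → IsTree G → Σ (Fin (size G) → Span) (IsSpanRepresentation G)
tree-representation G (1≤n , (adj-sym , _) , connected , acyclic) =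
  dfsSpan , λ u v u≢v → dfs-representation u≢v ⇔-∘ adjacent⇔parentOrChild u≢v
  where
  open SimplePaths G adj-sym acyclic
  open Rooted connected (Fin.fromℕ< 1≤n)
  open DepthFirst rootedTree

theorem25 :
    ((n : ℕ) → 1 ≤ n → IsDoubleApprovalIntervalGraph (K n)) ×
    ((n : ℕ) → 3 ≤ n → IsDoubleApprovalIntervalGraph (C n)) ×
    ((n : ℕ) → 3 ≤ n → IsDoubleApprovalIntervalGraph (W n)) ×
    ((m n : ℕ) → 1 ≤ m → 1 ≤ n → IsDoubleApprovalIntervalGraph (Kbip m n)) ×
    ((G : Graph) → IsTree G → IsDoubleApprovalIntervalGraph G)
theorem25 =
  (λ n _ → spanRepresentation⇒DAIG (K n) (completeSpan n) (complete-representation n)) ,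
  (λ n _ → spanRepresentation⇒DAIG (C n) (cycleSpan n) (cycle-representation n)) ,
  (λ n _ → spanRepresentation⇒DAIG (W n) (wheelSpan n) (wheel-representation n)) ,
  (λ m n _ _ → spanRepresentation⇒DAIG (Kbip m n) (completeBipartiteSpan m n)
                 (completeBipartite-representation m n)) ,
  (λ G tree → let (f , rep) = tree-representation G tree in spanRepresentation⇒DAIG G f rep)
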